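{- Fix integers $p\ge 2$ and $r\ge 1$, and let $S$ be a set with $n$ elements. Suppose $(A_{j1},\dots,A_{jp})$, $j=1,\dots,m$, are $m$ distinct weak partial compositions of $S$ into $p$ parts such that for each $k\in[p]$ the set $\{A_{jk}:1\le j\le m\}$ is $r$-chain-free. Then $m$ is at most the sum of the $r^p$ largest $(p+1)$-multinomial coefficients for $n$.
   Context: A weak partial composition of $S$ into $p$ parts is an ordered $p$-tuple $(A_1,\dots,A_p)$ of pairwise disjoint, possibly empty, sets with $A_1\cup\dots\cup A_p\subseteq S$. A family of subsets of $S$ is $r$-chain-free if every chain (set totally ordered by inclusion) in it has at most $r$ elements (the family is considered as a set, ignoring repetitions). $[p]=\{1,\dots,p\}$. The $(p+1)$-multinomial coefficients for $n$ are the numbers $\binom{n}{a_1,\dots,a_{p+1}}=\frac{n!}{a_1!\cdots a_{p+1}!}$, one for each ordered tuple $(a_1,\dots,a_{p+1})$ of nonnegative integers summing to $n$; the sum of the $R$ largest means: list them (with multiplicity, one per tuple) in non-increasing order, extended by zeros if necessary, and sum the first $R$. -}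

module Defs where

open import Data.Nat using (ℕ; zero; suc; _+_; _*_; _∸_; _≤_; NonZero; _!)
open import Data.Nat.Properties using (_!≢0; m*n≢0; ≤-decTotalOrder)
open import Data.Nat.DivMod using (_/_)

open import Data.Fin using (Fin)
open import Data.Fin.Subset using (Subset; _⊆_; _∩_; Empty)
open import Data.List using (List; []; _∷_; map; concatMap; upTo; take; reverse)
open import Data.Nat.ListAction using (sum)
open import Data.Vec as Vec using (Vec; lookup)
open import Data.Product using (∃; _×_)
open import Data.Sum using (_⊎_)
open import Data.Empty using (⊥)
open import Relation.Binary.PropositionalEquality using (_≡_; _≢_)
open import Function.Definitions using (Injective)
import Data.List.Sort.InsertionSort as Sort

WeakPartialComposition : ℕ → ℕ → Set
WeakPartialComposition n p = Vec (Subset n) p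

PairwiseDisjoint : ∀ {n p} → WeakPartialComposition n p → Set
PairwiseDisjoint {p = p} A =
  ∀ (i j : Fin p) → i ≢ j → Empty (lookup A i ∩ lookup A j)

ChainFree : ∀ {n m} → ℕ → (Fin m → Subset n) → Set
ChainFree {n} {m} r B =
  (c : Fin (suc r) → Subset n) →
  (∀ i → ∃ λ (j : Fin m) → B j ≡ c i) →
  Injective _≡_ _≡_ c →
  (∀ i i' → c i ⊆ c i' ⊎ c i' ⊆ c i) →
  ⊥

tuples : ℕ → (k : ℕ) → List (Vec ℕ k)
tuples zero    zero    = Vec.[] ∷ []
tuples (suc _) zero    = []
tuples n       (suc k) =
  concatMap (λ a → map (a Vec.∷_) (tuples (n ∸ a) k)) (upTo (suc n))

prodFact : ∀ {k} → Vec ℕ k → ℕ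
prodFact Vec.[]       = 1
prodFact (a Vec.∷ as) = a ! * prodFact as

prodFact≢0 : ∀ {k} (as : Vec ℕ k) → NonZero (prodFact as)
prodFact≢0 Vec.[] = _
prodFact≢0 (a Vec.∷ as) =
  m*n≢0 (a !) (prodFact as) {{a !≢0}} {{prodFact≢0 as}}

multinomial : ∀ {k} → ℕ → Vec ℕ k → ℕ
multinomial n as = (n ! / prodFact as) {{prodFact≢0 as}}

multinomials : ℕ → ℕ → List ℕ
multinomials n k = map (multinomial n) (tuples n k)

open Sort ≤-decTotalOrder using (sort)

-- Sum of the R largest entries of a list (padding with zeros if the
-- list is shorter than R, which does not change the sum).
sumLargest : ℕ → List ℕ → ℕ
sumLargest R xs = sum (take R (reverse (sort xs)))

{-# OPTIONS --safe #-}
-- A weak partial composition A of S, with part sizes a₁, …, aₚ and a₀ = n − Σ aᵢ uncovered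
-- elements, is compatible with a₀! a₁! ⋯ aₚ! of the n! orderings of S: those listing A₁ first,
-- then A₂, …, then the rest.  Lubell's chain-counting argument, applied one coordinate at a time,
-- shows that a family whose coordinates are r-chain-free has at most r^p · n! compatible pairs
-- (ordering, member).  Let x_v be the number of members of profile v = (a₀, …, aₚ) and
-- c_v = n!/(a₀! ⋯ aₚ!).  Members of one profile have parts of equal sizes, so each coordinate is
-- an antichain and x_v ≤ c_v; the count above gives Σ x_v / c_v ≤ r^p.  Under these constraints
-- Σ x_v is at most the sum of the r^p largest c_v: if t is the r^p-th largest c_v, then
-- x_v ≤ (c_v − t)⁺ + t x_v / c_v for every v, and summing these gives the bound.
module Submission where

open import Defs
import Algebra.Properties.CommutativeSemigroup as CommSemigroupProperties
open import Data.Bool using (if_then_else_)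
import Data.Bool as Bool
open import Data.Empty using (⊥; ⊥-elim)
open import Data.Fin using (Fin; zero; suc)
import Data.Fin.Properties as Fin
open import Data.Fin.Subset using (Subset; _⊆_; _∈_; _∉_; _─_; _-_; ∣_∣; ⁅_⁆; ⊤; inside; outside)
open import Data.Fin.Subset.Properties
  using (_∈?_; ⊆-refl; drop-∷-⊆; p⊆q⇒∣p∣≤∣q∣; p─q⊆p; x∈p∧x∉q⇒x∈p─q; x∈p∧x≢y⇒x∈p-y; x∈p⇒∣p-x∣<∣p∣;
         ∣⁅x⁆∣≡1; x∈⁅y⁆⇒x≡y; ∈⊤; ∣⊤∣≡n; x∈p∩q⁺)
open import Data.List
  using (List; []; _∷_; map; filter; tabulate; allFin; length; deduplicate; concatMap; upTo; take; reverse)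
open import Data.List.Properties using (map-tabulate; unfold-reverse; length-tabulate)
open import Data.List.Membership.Propositional using (lose; find) renaming (_∈_ to _∈ₗ_; _∉_ to _∉ₗ_)
open import Data.List.Membership.Propositional.Properties
  using (∈-filter⁻; ∈-map⁺; ∈-map⁻; ∈-deduplicate⁺; ∈-deduplicate⁻; ∈-++⁻; ∈-concatMap⁺; ∈-concatMap⁻;
         ∈-upTo⁺; ∈-upTo⁻; ∈-tabulate⁻)
import Data.List.Membership.DecPropositional as DecMembership
open import Data.List.Relation.Binary.Disjoint.Propositional using (Disjoint)
open import Data.List.Relation.Binary.Permutation.Propositional using (_↭_; ↭-trans)
import Data.List.Relation.Binary.Permutation.Propositional.Properties as Perm
open import Data.List.Relation.Unary.All as All using (All; []; _∷_)
open import Data.List.Relation.Unary.All.Properties using (¬Any⇒All¬)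
open import Data.List.Relation.Unary.AllPairs using (AllPairs; []; _∷_)
import Data.List.Relation.Unary.AllPairs.Properties as AllPairs
open import Data.List.Relation.Unary.Any using (here; there)
import Data.List.Relation.Unary.Any.Properties as Any
open import Data.List.Relation.Unary.Linked.Properties using (Linked⇒AllPairs)
open import Data.List.Relation.Unary.Unique.Propositional using (Unique)
import Data.List.Relation.Unary.Unique.Propositional.Properties as Unique
import Data.List.Relation.Unary.Unique.DecPropositional.Properties as UniqueDec
import Data.List.Sort.InsertionSort as InsertionSort
import Data.List.Sort.InsertionSort.Properties as InsertionSortProperties
open import Data.Nat using (ℕ; zero; suc; _+_; _*_; _∸_; _≤_; _<_; _≥_; z≤n; s≤s; s≤s⁻¹; _!; _^_; NonZero)
open import Data.Nat.Combinatorics using (k![n∸k]!∣n!)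
open import Data.Nat.Divisibility using (_∣_; ∣-trans; *-monoʳ-∣; 1∣_)
open import Data.Nat.DivMod using (m/n*n≡m)
open import Data.Nat.ListAction using (sum)
open import Data.Nat.ListAction.Properties using (sum-↭)
open import Data.Nat.Properties
open import Data.Nat.Solver using (module +-*-Solver)
open import Data.Product using (∃; _×_; _,_; proj₁; proj₂)
open import Data.Sum using (_⊎_; inj₁; inj₂)
open import Data.Vec using (Vec; []; _∷_; lookup; head; here; there)
import Data.Vec as Vec
open import Data.Vec.Properties using (≡-dec; ∷-injectiveʳ; lookup-map)
open import Function using (_∘_; id; flip)
open import Function.Definitions using (Injective)
open import Level using (0ℓ)
open import Relation.Binary.Definitions using (DecidableEquality)
open import Relation.Binary.PropositionalEquality
open import Relation.Nullary using (Dec; does; yes; no; ¬_)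
open import Relation.Unary using (Pred; Decidable)

open CommSemigroupProperties *-commutativeSemigroup using (x∙yz≈y∙xz)
open CommSemigroupProperties +-commutativeSemigroup using (interchange)
open InsertionSort ≤-decTotalOrder using (sort)
open InsertionSortProperties ≤-decTotalOrder using (sort-↗; sort-↭)

𝟙 : ∀ {a} {A : Set a} → Dec A → ℕ
𝟙 d = if does d then 1 else 0

module _ {a} {A : Set a} where

  ∑ : List A → (A → ℕ) → ℕ
  ∑ xs f = sum (map f xs)

  infix 5 ∑
  syntax ∑ xs (λ x → e) = ∑[ x ∈ xs ] e

  ∑-cong : ∀ xs {f g : A → ℕ} → (∀ {x} → x ∈ₗ xs → f x ≡ g x) → ∑ xs f ≡ ∑ xs g
  ∑-cong []       _  = refl
  ∑-cong (x ∷ xs) eq = cong₂ _+_ (eq (here refl)) (∑-cong xs (eq ∘ there))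

  ∑-mono-≤ : ∀ xs {f g : A → ℕ} → (∀ {x} → x ∈ₗ xs → f x ≤ g x) → ∑ xs f ≤ ∑ xs g
  ∑-mono-≤ []       _  = z≤n
  ∑-mono-≤ (x ∷ xs) le = +-mono-≤ (le (here refl)) (∑-mono-≤ xs (le ∘ there))

  ∑-zero : ∀ xs → ∑[ x ∈ xs ] 0 ≡ 0
  ∑-zero []       = refl
  ∑-zero (_ ∷ xs) = ∑-zero xs

  ∑-one : ∀ xs → ∑[ x ∈ xs ] 1 ≡ length xs
  ∑-one []       = refl
  ∑-one (_ ∷ xs) = cong suc (∑-one xs)

  ∑-distrib-+ : ∀ xs (f g : A → ℕ) → ∑[ x ∈ xs ] (f x + g x) ≡ ∑ xs f + ∑ xs g
  ∑-distrib-+ []       f g = refl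
  ∑-distrib-+ (x ∷ xs) f g =
    trans (cong (f x + g x +_) (∑-distrib-+ xs f g)) (interchange (f x) (g x) (∑ xs f) (∑ xs g))

  *-distribˡ-∑ : ∀ xs k (f : A → ℕ) → ∑[ x ∈ xs ] (k * f x) ≡ k * ∑ xs f
  *-distribˡ-∑ []       k f = sym (*-zeroʳ k)
  *-distribˡ-∑ (x ∷ xs) k f =
    trans (cong (k * f x +_) (*-distribˡ-∑ xs k f)) (sym (*-distribˡ-+ k (f x) (∑ xs f)))

  *-distribʳ-∑ : ∀ xs k (f : A → ℕ) → ∑[ x ∈ xs ] (f x * k) ≡ ∑ xs f * k
  *-distribʳ-∑ []       k f = refl
  *-distribʳ-∑ (x ∷ xs) k f =
    trans (cong (f x * k +_) (*-distribʳ-∑ xs k f)) (sym (*-distribʳ-+ k (f x) (∑ xs f)))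

  ∑-filter : ∀ {p} {P : Pred A p} (P? : Decidable P) xs (f : A → ℕ) →
    ∑ (filter P? xs) f ≡ ∑[ x ∈ xs ] (𝟙 (P? x) * f x)
  ∑-filter P? []       f = refl
  ∑-filter P? (x ∷ xs) f with P? x
  ... | yes _ = cong₂ _+_ (sym (+-identityʳ (f x))) (∑-filter P? xs f)
  ... | no  _ = ∑-filter P? xs f

module _ {a b} {A : Set a} {B : Set b} where

  ∑-map : ∀ xs (g : A → B) (f : B → ℕ) → ∑ (map g xs) f ≡ ∑[ x ∈ xs ] f (g x)
  ∑-map []       g f = refl
  ∑-map (x ∷ xs) g f = cong (f (g x) +_) (∑-map xs g f)

  ∑-comm : ∀ xs ys (h : A → B → ℕ) → ∑[ x ∈ xs ] ∑[ y ∈ ys ] h x y ≡ ∑[ y ∈ ys ] ∑[ x ∈ xs ] h x y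
  ∑-comm []       ys h = sym (∑-zero ys)
  ∑-comm (x ∷ xs) ys h = trans (cong (∑ ys (h x) +_) (∑-comm xs ys h))
                               (sym (∑-distrib-+ ys (h x) (λ y → ∑[ x′ ∈ xs ] h x′ y)))

𝟙≡-*-cong : ∀ {a} {A : Set a} {x y : A} (d : Dec (x ≡ y)) (f : A → ℕ) → 𝟙 d * f y ≡ 𝟙 d * f x
𝟙≡-*-cong (yes refl) f = refl
𝟙≡-*-cong (no _)     f = refl

module _ {a} {A : Set a} (_≟_ : DecidableEquality A) where

  ∑-𝟙≡-∉ : ∀ {y} xs → y ∉ₗ xs → ∑[ x ∈ xs ] 𝟙 (y ≟ x) ≡ 0
  ∑-𝟙≡-∉     []       _  = refl
  ∑-𝟙≡-∉ {y} (x ∷ xs) y∉ with y ≟ x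
  ... | yes y≡x = ⊥-elim (y∉ (here y≡x))
  ... | no  _   = ∑-𝟙≡-∉ xs (y∉ ∘ there)

  ∑-𝟙≡-∈ : ∀ {y} xs → Unique xs → y ∈ₗ xs → ∑[ x ∈ xs ] 𝟙 (y ≟ x) ≡ 1
  ∑-𝟙≡-∈ {y} (x ∷ xs) uniq@(_ ∷ uniq′) y∈ with y ≟ x | y∈
  ... | yes refl | _          = cong suc (∑-𝟙≡-∉ xs (Unique.Unique[x∷xs]⇒x∉xs uniq))
  ... | no  y≢x  | here y≡x   = ⊥-elim (y≢x y≡x)
  ... | no  _    | there y∈xs = ∑-𝟙≡-∈ xs uniq′ y∈xs

  ∑-partition : ∀ {b} {B : Set b} (key : B → A) xs ys (f : B → ℕ) →
    Unique ys → (∀ {x} → x ∈ₗ xs → key x ∈ₗ ys) →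
    ∑ xs f ≡ ∑[ y ∈ ys ] ∑[ x ∈ xs ] 𝟙 (key x ≟ y) * f x
  ∑-partition key xs ys f uniq key∈ = begin
    ∑ xs f                                        ≡⟨ ∑-cong xs (sym ∘ counted-once) ⟩
    ∑[ x ∈ xs ] ∑[ y ∈ ys ] 𝟙 (key x ≟ y) * f x   ≡⟨ ∑-comm xs ys _ ⟩
    ∑[ y ∈ ys ] ∑[ x ∈ xs ] 𝟙 (key x ≟ y) * f x   ∎
    where
    open ≡-Reasoning
    counted-once : ∀ {x} → x ∈ₗ xs → ∑[ y ∈ ys ] 𝟙 (key x ≟ y) * f x ≡ f x
    counted-once {x} x∈ = begin
      ∑[ y ∈ ys ] 𝟙 (key x ≟ y) * f x     ≡⟨ *-distribʳ-∑ ys (f x) _ ⟩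
      (∑[ y ∈ ys ] 𝟙 (key x ≟ y)) * f x   ≡⟨ cong (_* f x) (∑-𝟙≡-∈ ys uniq (key∈ x∈)) ⟩
      1 * f x                             ≡⟨ *-identityˡ (f x) ⟩
      f x                                 ∎

_≟ₛ_ : ∀ {n} → DecidableEquality (Subset n)
_≟ₛ_ = ≡-dec Bool._≟_

_∈ₗ?_ : ∀ {n} (B : Subset n) D → Dec (B ∈ₗ D)
B ∈ₗ? D = DecMembership._∈?_ _≟ₛ_ B D

q⊆p⇒∣p─q∣≡∣p∣∸∣q∣ : ∀ {n} {p q : Subset n} → q ⊆ p → ∣ p ─ q ∣ ≡ ∣ p ∣ ∸ ∣ q ∣
q⊆p⇒∣p─q∣≡∣p∣∸∣q∣ {p = []}          {[]}          _   = refl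
q⊆p⇒∣p─q∣≡∣p∣∸∣q∣ {p = inside  ∷ p} {inside  ∷ q} q⊆p = q⊆p⇒∣p─q∣≡∣p∣∸∣q∣ (drop-∷-⊆ q⊆p)
q⊆p⇒∣p─q∣≡∣p∣∸∣q∣ {p = outside ∷ p} {inside  ∷ q} q⊆p with () ← q⊆p here
q⊆p⇒∣p─q∣≡∣p∣∸∣q∣ {p = inside  ∷ p} {outside ∷ q} q⊆p = begin
  suc ∣ p ─ q ∣      ≡⟨ cong suc (q⊆p⇒∣p─q∣≡∣p∣∸∣q∣ (drop-∷-⊆ q⊆p)) ⟩
  suc (∣ p ∣ ∸ ∣ q ∣) ≡⟨ +-∸-assoc 1 (p⊆q⇒∣p∣≤∣q∣ (drop-∷-⊆ q⊆p)) ⟨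
  suc ∣ p ∣ ∸ ∣ q ∣   ∎
  where open ≡-Reasoning
q⊆p⇒∣p─q∣≡∣p∣∸∣q∣ {p = outside ∷ p} {outside ∷ q} q⊆p = q⊆p⇒∣p─q∣≡∣p∣∸∣q∣ (drop-∷-⊆ q⊆p)

p⊆q∧∣p∣≡∣q∣⇒p≡q : ∀ {n} {p q : Subset n} → p ⊆ q → ∣ p ∣ ≡ ∣ q ∣ → p ≡ q
p⊆q∧∣p∣≡∣q∣⇒p≡q {p = []}          {[]}          _   _ = refl
p⊆q∧∣p∣≡∣q∣⇒p≡q {p = inside  ∷ p} {inside  ∷ q} p⊆q e =
  cong (inside ∷_) (p⊆q∧∣p∣≡∣q∣⇒p≡q (drop-∷-⊆ p⊆q) (suc-injective e))
p⊆q∧∣p∣≡∣q∣⇒p≡q {p = inside  ∷ p} {outside ∷ q} p⊆q e with () ← p⊆q here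
p⊆q∧∣p∣≡∣q∣⇒p≡q {p = outside ∷ p} {inside  ∷ q} p⊆q e =
  ⊥-elim (<-irrefl e (s≤s (p⊆q⇒∣p∣≤∣q∣ (drop-∷-⊆ p⊆q))))
p⊆q∧∣p∣≡∣q∣⇒p≡q {p = outside ∷ p} {outside ∷ q} p⊆q e =
  cong (outside ∷_) (p⊆q∧∣p∣≡∣q∣⇒p≡q (drop-∷-⊆ p⊆q) e)

x∈p─q⇒x∉q : ∀ {n} (p q : Subset n) {x} → x ∈ p ─ q → x ∉ q
x∈p─q⇒x∉q (inside  ∷ p) (outside ∷ q) here ()
x∈p─q⇒x∉q (_       ∷ p) (_       ∷ q) (there x∈p─q) (there x∈q) = x∈p─q⇒x∉q p q x∈p─q x∈q

x∈p⇒⁅x⁆⊆p : ∀ {n} {x : Fin n} {p} → x ∈ p → ⁅ x ⁆ ⊆ p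
x∈p⇒⁅x⁆⊆p {x = x} x∈p y∈⁅x⁆ = subst (_∈ _) (sym (x∈⁅y⁆⇒x≡y x y∈⁅x⁆)) x∈p

x∈p⇒∣p-x∣≡∣p∣∸1 : ∀ {n} {x : Fin n} {p} → x ∈ p → ∣ p - x ∣ ≡ ∣ p ∣ ∸ 1
x∈p⇒∣p-x∣≡∣p∣∸1 {x = x} x∈p = trans (q⊆p⇒∣p─q∣≡∣p∣∸∣q∣ (x∈p⇒⁅x⁆⊆p x∈p)) (cong (_ ∸_) (∣⁅x⁆∣≡1 x))

∑-allFin-suc : ∀ {n} (f : Fin (suc n) → ℕ) →
  ∑ (allFin (suc n)) f ≡ f zero + (∑[ x ∈ allFin n ] f (suc x))
∑-allFin-suc f =
  cong (λ xs → f zero + sum xs) (trans (map-tabulate suc f) (sym (map-tabulate id (f ∘ suc))))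

∑-𝟙∈≡∣p∣ : ∀ {n} (p : Subset n) → ∑[ x ∈ allFin n ] 𝟙 (x ∈? p) ≡ ∣ p ∣
∑-𝟙∈≡∣p∣ []            = refl
∑-𝟙∈≡∣p∣ (inside  ∷ p) = trans (∑-allFin-suc (λ x → 𝟙 (x ∈? inside ∷ p))) (cong suc (∑-𝟙∈≡∣p∣ p))
∑-𝟙∈≡∣p∣ (outside ∷ p) = trans (∑-allFin-suc (λ x → 𝟙 (x ∈? outside ∷ p))) (∑-𝟙∈≡∣p∣ p)

-- Chain-free families and the LYM inequality

IsChainFree : ∀ {n ℓ} → ℕ → Pred (Subset n) ℓ → Set ℓ
IsChainFree {n} r P =
  (c : Fin (suc r) → Subset n) → (∀ i → P (c i)) → Injective _≡_ _≡_ c →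
  (∀ i i′ → c i ⊆ c i′ ⊎ c i′ ⊆ c i) → ⊥

module _ {n ℓ} {P : Pred (Subset n) ℓ} where

  isChainFree-restrict : ∀ {ℓ′} {Q : Pred (Subset n) ℓ′} {r} →
    (∀ {S} → Q S → P S) → IsChainFree r P → IsChainFree r Q
  isChainFree-restrict Q⇒P cf c c∈Q = cf c (Q⇒P ∘ c∈Q)

  isChainFree-zero : ∀ {S} → IsChainFree 0 P → ¬ P S
  isChainFree-zero {S} cf S∈P =
    cf (λ _ → S) (λ _ → S∈P) (λ { {zero} {zero} _ → refl }) (λ _ _ → inj₁ ⊆-refl)

  isChainFree-belowTop : ∀ {ℓ′} {Q : Pred (Subset n) ℓ′} {r U} →
    P U → (∀ {S} → P S → S ⊆ U) → (∀ {S} → Q S → P S) → (∀ {S} → Q S → S ≢ U) →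
    IsChainFree (suc r) P → IsChainFree r Q
  isChainFree-belowTop {r = r} {U} U∈P P⊆U Q⇒P Q≢U cf c c∈Q c-inj c-chain =
    cf c′ c′∈P c′-inj c′-chain
    where
    c′ : Fin (suc (suc r)) → Subset n
    c′ zero    = U
    c′ (suc i) = c i
    c′∈P : ∀ i → P (c′ i)
    c′∈P zero    = U∈P
    c′∈P (suc i) = Q⇒P (c∈Q i)
    c′-inj : Injective _≡_ _≡_ c′
    c′-inj {zero}  {zero}  _ = refl
    c′-inj {zero}  {suc j} e = ⊥-elim (Q≢U (c∈Q j) (sym e))
    c′-inj {suc i} {zero}  e = ⊥-elim (Q≢U (c∈Q i) e)
    c′-inj {suc i} {suc j} e = cong suc (c-inj e)
    c′-chain : ∀ i i′ → c′ i ⊆ c′ i′ ⊎ c′ i′ ⊆ c′ i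
    c′-chain zero    zero     = inj₁ ⊆-refl
    c′-chain zero    (suc i′) = inj₂ (P⊆U (c′∈P (suc i′)))
    c′-chain (suc i) zero     = inj₁ (P⊆U (c′∈P (suc i)))
    c′-chain (suc i) (suc i′) = c-chain i i′

  equalSize⇒isChainFree1 : ∀ {k} → (∀ {S} → P S → ∣ S ∣ ≡ k) → IsChainFree 1 P
  equalSize⇒isChainFree1 size c c∈P c-inj c-chain =
    Fin.0≢1+n (c-inj (comparable⇒≡ (c-chain zero (suc zero))))
    where
    ∣c∣≡ : ∀ i j → ∣ c i ∣ ≡ ∣ c j ∣
    ∣c∣≡ i j = trans (size (c∈P i)) (sym (size (c∈P j)))
    comparable⇒≡ : c zero ⊆ c (suc zero) ⊎ c (suc zero) ⊆ c zero → c zero ≡ c (suc zero)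
    comparable⇒≡ (inj₁ c₀⊆c₁) = p⊆q∧∣p∣≡∣q∣⇒p≡q c₀⊆c₁ (∣c∣≡ zero (suc zero))
    comparable⇒≡ (inj₂ c₁⊆c₀) = sym (p⊆q∧∣p∣≡∣q∣⇒p≡q c₁⊆c₀ (∣c∣≡ (suc zero) zero))

-- The number of maximal chains of a u-element set that pass through B.
lubellWeight : ∀ {n} → ℕ → Subset n → ℕ
lubellWeight u B = ∣ B ∣ ! * (u ∸ ∣ B ∣) !

m<n⇒[n∸m]*[n∸1∸m]!≡[n∸m]! : ∀ {m n} → m < n → (n ∸ m) * (n ∸ 1 ∸ m) ! ≡ (n ∸ m) !
m<n⇒[n∸m]*[n∸1∸m]!≡[n∸m]! (s≤s m≤n) rewrite +-∸-assoc 1 m≤n = refl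

n*[n∸1]!≤n! : ∀ n → n * (n ∸ 1) ! ≤ n !
n*[n∸1]!≤n! zero    = z≤n
n*[n∸1]!≤n! (suc n) = ≤-refl

-- A maximal chain of U through B ≠ U is a maximal chain of U - x through B followed by U,
-- for a unique x ∈ U ─ B.
lubellWeight-step : ∀ {n} {U B : Subset n} → B ⊆ U →
  lubellWeight ∣ U ∣ B ≤ 𝟙 (U ≟ₛ B) * ∣ U ∣ ! + ∣ U ─ B ∣ * lubellWeight (∣ U ∣ ∸ 1) B
lubellWeight-step {U = U} {B} B⊆U with U ≟ₛ B
... | yes refl = begin
  ∣ U ∣ ! * (∣ U ∣ ∸ ∣ U ∣) !  ≡⟨ cong (λ k → ∣ U ∣ ! * k !) (n∸n≡0 ∣ U ∣) ⟩
  ∣ U ∣ ! * 1                 ≡⟨ *-identityʳ (∣ U ∣ !) ⟩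
  ∣ U ∣ !                     ≡⟨ *-identityˡ (∣ U ∣ !) ⟨
  1 * ∣ U ∣ !                 ≤⟨ m≤m+n (1 * ∣ U ∣ !) _ ⟩
  1 * ∣ U ∣ ! + ∣ U ─ U ∣ * lubellWeight (∣ U ∣ ∸ 1) U ∎
  where open ≤-Reasoning
... | no U≢B = ≤-reflexive (begin
  ∣ B ∣ ! * (u ∸ b) !                  ≡⟨ cong (∣ B ∣ ! *_) (m<n⇒[n∸m]*[n∸1∸m]!≡[n∸m]! b<u) ⟨
  ∣ B ∣ ! * ((u ∸ b) * (u ∸ 1 ∸ b) !)  ≡⟨ x∙yz≈y∙xz (∣ B ∣ !) (u ∸ b) _ ⟩
  (u ∸ b) * lubellWeight (u ∸ 1) B     ≡⟨ cong (_* lubellWeight (u ∸ 1) B) (q⊆p⇒∣p─q∣≡∣p∣∸∣q∣ B⊆U) ⟨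
  ∣ U ─ B ∣ * lubellWeight (u ∸ 1) B   ∎)
  where
  open ≡-Reasoning
  u = ∣ U ∣
  b = ∣ B ∣
  b<u : b < u
  b<u = ≤∧≢⇒< (p⊆q⇒∣p∣≤∣q∣ B⊆U) (U≢B ∘ sym ∘ p⊆q∧∣p∣≡∣q∣⇒p≡q B⊆U)

LubellBound : ∀ {n} → Subset n → Set
LubellBound {n} U = ∀ r (D : List (Subset n)) → Unique D → (∀ {B} → B ∈ₗ D → B ⊆ U) →
  IsChainFree r (_∈ₗ D) → ∑[ B ∈ D ] lubellWeight ∣ U ∣ B ≤ r * ∣ U ∣ !

avoiding : ∀ {n} → Fin n → Subset n → List (Subset n) → List (Subset n)
avoiding x U = filter (λ B → x ∈? U ─ B)

∈-avoiding⁻ : ∀ {n} {x : Fin n} {U D B} → B ∈ₗ avoiding x U D → B ∈ₗ D × x ∈ U ─ B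
∈-avoiding⁻ {x = x} {U} = ∈-filter⁻ (λ B → x ∈? U ─ B)

-- r′ is r less the multiplicity of U in D: when U ∈ D, it tops every chain of members missing x.
avoiding-isChainFree : ∀ {n} {U : Subset n} {D} r → Unique D → (∀ {B} → B ∈ₗ D → B ⊆ U) →
  IsChainFree r (_∈ₗ D) →
  ∃ λ r′ → (∑[ B ∈ D ] 𝟙 (U ≟ₛ B)) + r′ ≤ r × (∀ x → IsChainFree r′ (_∈ₗ avoiding x U D))
avoiding-isChainFree {U = U} {D} r uniq D⊆U cf with U ∈ₗ? D | r
... | no U∉D | r = r , ≤-reflexive (cong (_+ r) (∑-𝟙≡-∉ _≟ₛ_ D U∉D)) , λ x →
  isChainFree-restrict {P = _∈ₗ D} (proj₁ ∘ ∈-avoiding⁻ {D = D}) cf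
... | yes U∈D | zero   = ⊥-elim (isChainFree-zero {P = _∈ₗ D} cf U∈D)
... | yes U∈D | suc r′ = r′ , ≤-reflexive (cong (_+ r′) (∑-𝟙≡-∈ _≟ₛ_ D uniq U∈D)) , λ x →
  isChainFree-belowTop {P = _∈ₗ D} U∈D D⊆U
    (proj₁ ∘ ∈-avoiding⁻ {D = D}) (≢U x ∘ proj₂ ∘ ∈-avoiding⁻ {D = D}) cf
  where
  ≢U : ∀ x {B} → x ∈ U ─ B → B ≢ U
  ≢U x x∈U─U refl = x∈p─q⇒x∉q U U x∈U─U (p─q⊆p U U x∈U─U)

∑-avoiding≤ : ∀ {n} {U : Subset n} {D r} x → (x ∈ U → LubellBound (U - x)) →
  Unique D → (∀ {B} → B ∈ₗ D → B ⊆ U) → IsChainFree r (_∈ₗ avoiding x U D) →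
  ∑[ B ∈ D ] 𝟙 (x ∈? U ─ B) * lubellWeight (∣ U ∣ ∸ 1) B ≤ 𝟙 (x ∈? U) * (r * (∣ U ∣ ∸ 1) !)
∑-avoiding≤ {U = U} {D} {r} x bound uniq D⊆U cf
  rewrite sym (∑-filter (λ B → x ∈? U ─ B) D (lubellWeight (∣ U ∣ ∸ 1))) with x ∈? U
... | yes x∈U = begin
  ∑ Dₓ (lubellWeight (∣ U ∣ ∸ 1))  ≡⟨ cong (λ u → ∑ Dₓ (lubellWeight u)) (x∈p⇒∣p-x∣≡∣p∣∸1 x∈U) ⟨
  ∑ Dₓ (lubellWeight ∣ U - x ∣)    ≤⟨ bound x∈U r Dₓ (Unique.filter⁺ _ uniq) Dₓ⊆U-x cf ⟩
  r * ∣ U - x ∣ !                  ≡⟨ cong (λ u → r * u !) (x∈p⇒∣p-x∣≡∣p∣∸1 x∈U) ⟩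
  r * (∣ U ∣ ∸ 1) !                ≡⟨ +-identityʳ _ ⟨
  1 * (r * (∣ U ∣ ∸ 1) !)          ∎
  where
  open ≤-Reasoning
  Dₓ = avoiding x U D
  Dₓ⊆U-x : ∀ {B} → B ∈ₗ Dₓ → B ⊆ U - x
  Dₓ⊆U-x B∈Dₓ y∈B with B∈D , x∈U─B ← ∈-avoiding⁻ {D = D} B∈Dₓ =
    x∈p∧x≢y⇒x∈p-y (D⊆U B∈D y∈B) λ { refl → x∈p─q⇒x∉q U _ x∈U─B y∈B }
... | no x∉U = ≤-trans (∑-mono-≤ (avoiding x U D) {g = λ _ → 0} (⊥-elim ∘ x∉U ∘ x∈U))
                       (≤-reflexive (∑-zero (avoiding x U D)))
  where
  x∈U : ∀ {B} → B ∈ₗ avoiding x U D → x ∈ U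
  x∈U B∈Dₓ = p─q⊆p U _ (proj₂ (∈-avoiding⁻ {D = D} B∈Dₓ))

lym-step : ∀ {n} {U : Subset n} → (∀ {x} → x ∈ U → LubellBound (U - x)) → LubellBound U
lym-step {n} {U} bound r D uniq D⊆U cf with avoiding-isChainFree r uniq D⊆U cf
... | r′ , c+r′≤r , avoiding-cf = begin
  ∑[ B ∈ D ] lubellWeight u B
    ≤⟨ ∑-mono-≤ D (lubellWeight-step ∘ D⊆U) ⟩
  ∑[ B ∈ D ] 𝟙 (U ≟ₛ B) * u ! + ∣ U ─ B ∣ * lubellWeight (u ∸ 1) B
    ≡⟨ ∑-distrib-+ D _ _ ⟩
  (∑[ B ∈ D ] 𝟙 (U ≟ₛ B) * u !) + (∑[ B ∈ D ] ∣ U ─ B ∣ * lubellWeight (u ∸ 1) B)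
    ≡⟨ cong₂ _+_ (*-distribʳ-∑ D (u !) _) (∑-cong D (λ {B} _ → ∣U─B∣-as-∑ B)) ⟩
  c * u ! + (∑[ B ∈ D ] ∑[ x ∈ allFin n ] 𝟙 (x ∈? U ─ B) * lubellWeight (u ∸ 1) B)
    ≡⟨ cong (c * u ! +_) (∑-comm D (allFin n) _) ⟩
  c * u ! + (∑[ x ∈ allFin n ] ∑[ B ∈ D ] 𝟙 (x ∈? U ─ B) * lubellWeight (u ∸ 1) B)
    ≤⟨ +-monoʳ-≤ (c * u !) (∑-mono-≤ (allFin n) λ {x} _ →
                               ∑-avoiding≤ x bound uniq D⊆U (avoiding-cf x)) ⟩
  c * u ! + (∑[ x ∈ allFin n ] 𝟙 (x ∈? U) * (r′ * (u ∸ 1) !))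
    ≡⟨ cong (c * u ! +_) (trans (*-distribʳ-∑ (allFin n) _ (λ x → 𝟙 (x ∈? U)))
                                (cong (_* (r′ * (u ∸ 1) !)) (∑-𝟙∈≡∣p∣ U))) ⟩
  c * u ! + u * (r′ * (u ∸ 1) !)
    ≡⟨ cong (c * u ! +_) (x∙yz≈y∙xz u r′ _) ⟩
  c * u ! + r′ * (u * (u ∸ 1) !)
    ≤⟨ +-monoʳ-≤ (c * u !) (*-monoʳ-≤ r′ (n*[n∸1]!≤n! u)) ⟩
  c * u ! + r′ * u !
    ≡⟨ *-distribʳ-+ (u !) c r′ ⟨
  (c + r′) * u !
    ≤⟨ *-monoˡ-≤ (u !) c+r′≤r ⟩
  r * u ! ∎
  where
  open ≤-Reasoning
  u = ∣ U ∣
  c = ∑[ B ∈ D ] 𝟙 (U ≟ₛ B)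
  ∣U─B∣-as-∑ : ∀ B → ∣ U ─ B ∣ * lubellWeight (u ∸ 1) B ≡
    ∑[ x ∈ allFin n ] 𝟙 (x ∈? U ─ B) * lubellWeight (u ∸ 1) B
  ∣U─B∣-as-∑ B = trans (cong (_* lubellWeight (u ∸ 1) B) (sym (∑-𝟙∈≡∣p∣ (U ─ B))))
                       (sym (*-distribʳ-∑ (allFin n) _ (λ x → 𝟙 (x ∈? U ─ B))))

lym : ∀ {n} (U : Subset n) → LubellBound U
lym {n} U = bounded (suc ∣ U ∣) U ≤-refl
  where
  bounded : ∀ k (U : Subset n) → ∣ U ∣ < k → LubellBound U
  bounded (suc k) U ∣U∣<1+k =
    lym-step λ x∈U → bounded k _ (<-≤-trans (x∈p⇒∣p-x∣<∣p∣ x∈U) (s≤s⁻¹ ∣U∣<1+k))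

-- Compositions

data DisjointIn {n} : ∀ {p} → Subset n → Vec (Subset n) p → Set where
  []  : ∀ {U} → DisjointIn U []
  _∷_ : ∀ {p U B} {A : Vec (Subset n) p} → B ⊆ U → DisjointIn (U ─ B) A → DisjointIn U (B ∷ A)

pairwiseDisjoint⇒disjointIn : ∀ {n p} {U : Subset n} (A : Vec (Subset n) p) →
  PairwiseDisjoint A → (∀ k → lookup A k ⊆ U) → DisjointIn U A
pairwiseDisjoint⇒disjointIn []      _        _   = []
pairwiseDisjoint⇒disjointIn (B ∷ A) disjoint A⊆U = A⊆U zero ∷ pairwiseDisjoint⇒disjointIn A
  (λ i j i≢j → disjoint (suc i) (suc j) (i≢j ∘ Fin.suc-injective)) A⊆U─B
  where
  A⊆U─B : ∀ k → lookup A k ⊆ _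
  A⊆U─B k x∈Aₖ = x∈p∧x∉q⇒x∈p─q (A⊆U (suc k) x∈Aₖ) λ x∈B →
    disjoint zero (suc k) (λ ()) (_ , x∈p∩q⁺ (x∈B , x∈Aₖ))

module _ {n p} {U B : Subset n} {A : Vec (Subset n) p} where

  disjointIn-head : DisjointIn U (B ∷ A) → B ⊆ U
  disjointIn-head (B⊆U ∷ _) = B⊆U

  disjointIn-tail : DisjointIn U (B ∷ A) → DisjointIn (U ─ B) A
  disjointIn-tail (_ ∷ disjoint) = disjoint

sizes : ∀ {n p} → Vec (Subset n) p → Vec ℕ p
sizes = Vec.map ∣_∣

profile : ∀ {n p} → Subset n → Vec (Subset n) p → Vec ℕ (suc p)
profile U A = ∣ U ∣ ∸ Vec.sum (sizes A) ∷ sizes A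

sum-sizes≤ : ∀ {n p} {U : Subset n} {A : Vec (Subset n) p} →
  DisjointIn U A → Vec.sum (sizes A) ≤ ∣ U ∣
sum-sizes≤ []                                 = z≤n
sum-sizes≤ {U = U} {B ∷ A} (B⊆U ∷ A-disjoint) = begin
  ∣ B ∣ + Vec.sum (sizes A) ≤⟨ +-monoʳ-≤ ∣ B ∣ (sum-sizes≤ A-disjoint) ⟩
  ∣ B ∣ + ∣ U ─ B ∣         ≡⟨ cong (∣ B ∣ +_) (q⊆p⇒∣p─q∣≡∣p∣∸∣q∣ B⊆U) ⟩
  ∣ B ∣ + (∣ U ∣ ∸ ∣ B ∣)   ≡⟨ m+[n∸m]≡n (p⊆q⇒∣p∣≤∣q∣ B⊆U) ⟩
  ∣ U ∣                     ∎
  where open ≤-Reasoning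

sum-profile : ∀ {n p} {U : Subset n} {A : Vec (Subset n) p} →
  DisjointIn U A → Vec.sum (profile U A) ≡ ∣ U ∣
sum-profile A-disjoint = m∸n+n≡m (sum-sizes≤ A-disjoint)

-- The number of orderings of U listing the elements of A₁ first, then those of A₂, …, then the
-- rest of U: the analogue of lubellWeight for compositions.
weight : ∀ {n p} → Subset n → Vec (Subset n) p → ℕ
weight U A = prodFact (profile U A)

weight-∷ : ∀ {n p} {U B : Subset n} (A : Vec (Subset n) p) → B ⊆ U →
  weight U (B ∷ A) ≡ ∣ B ∣ ! * weight (U ─ B) A
weight-∷ {U = U} {B} A B⊆U = begin
  (∣ U ∣ ∸ (∣ B ∣ + s)) ! * (∣ B ∣ ! * π)
    ≡⟨ cong (λ k → k ! * (∣ B ∣ ! * π)) (∸-+-assoc ∣ U ∣ ∣ B ∣ s) ⟨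
  (∣ U ∣ ∸ ∣ B ∣ ∸ s) ! * (∣ B ∣ ! * π)
    ≡⟨ cong (λ k → (k ∸ s) ! * (∣ B ∣ ! * π)) (q⊆p⇒∣p─q∣≡∣p∣∸∣q∣ B⊆U) ⟨
  (∣ U ─ B ∣ ∸ s) ! * (∣ B ∣ ! * π)
    ≡⟨ x∙yz≈y∙xz ((∣ U ─ B ∣ ∸ s) !) (∣ B ∣ !) π ⟩
  ∣ B ∣ ! * weight (U ─ B) A ∎
  where
  open ≡-Reasoning
  s = Vec.sum (sizes A)
  π = prodFact (sizes A)

PartsAt : ∀ {n p} → List (Vec (Subset n) p) → Fin p → Pred (Subset n) 0ℓ
PartsAt F k S = ∃ λ A → A ∈ₗ F × lookup A k ≡ S

tailsWithHead : ∀ {n p} → Subset n → List (Vec (Subset n) (suc p)) → List (Vec (Subset n) p)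
tailsWithHead B []            = []
tailsWithHead B ((C ∷ A) ∷ F) with C ≟ₛ B
... | yes _ = A ∷ tailsWithHead B F
... | no  _ = tailsWithHead B F

module _ {n p : ℕ} (B : Subset n) where

  ∈-tailsWithHead⁻ : ∀ (F : List (Vec (Subset n) (suc p))) {A} →
    A ∈ₗ tailsWithHead B F → (B ∷ A) ∈ₗ F
  ∈-tailsWithHead⁻ ((C ∷ A′) ∷ F) A∈ with C ≟ₛ B | A∈
  ... | yes refl | here refl = here refl
  ... | yes _    | there A∈F = there (∈-tailsWithHead⁻ F A∈F)
  ... | no  _    | A∈F       = there (∈-tailsWithHead⁻ F A∈F)

  tailsWithHead-unique : ∀ {F : List (Vec (Subset n) (suc p))} →
    Unique F → Unique (tailsWithHead B F)
  tailsWithHead-unique {[]}          []               = []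
  tailsWithHead-unique {(C ∷ A) ∷ F} uniq@(_ ∷ uniq′) with C ≟ₛ B
  ... | yes refl = ¬Any⇒All¬ _ (Unique.Unique[x∷xs]⇒x∉xs uniq ∘ ∈-tailsWithHead⁻ F)
                 ∷ tailsWithHead-unique uniq′
  ... | no  _    = tailsWithHead-unique uniq′

  ∑-tailsWithHead : ∀ {U} (F : List (Vec (Subset n) (suc p))) →
    (∀ {A} → A ∈ₗ F → DisjointIn U A) →
    ∑[ A ∈ F ] 𝟙 (head A ≟ₛ B) * weight U A ≡ ∣ B ∣ ! * ∑ (tailsWithHead B F) (weight (U ─ B))
  ∑-tailsWithHead     []            _        = sym (*-zeroʳ (∣ B ∣ !))
  ∑-tailsWithHead {U} ((C ∷ A) ∷ F) disjoint with C ≟ₛ B | disjoint (here refl)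
  ... | yes refl | C⊆U ∷ _ = begin
    1 * weight U (C ∷ A) + rest
      ≡⟨ cong (_+ rest) (*-identityˡ _) ⟩
    weight U (C ∷ A) + rest
      ≡⟨ cong₂ _+_ (weight-∷ A C⊆U) (∑-tailsWithHead F (disjoint ∘ there)) ⟩
    ∣ C ∣ ! * weight U′ A + ∣ C ∣ ! * ∑ Fᶜ (weight U′)
      ≡⟨ *-distribˡ-+ (∣ C ∣ !) _ _ ⟨
    ∣ C ∣ ! * ∑ (A ∷ Fᶜ) (weight U′) ∎
    where
    open ≡-Reasoning
    U′ = U ─ C
    Fᶜ = tailsWithHead C F
    rest = ∑[ A′ ∈ F ] 𝟙 (head A′ ≟ₛ C) * weight U A′
  ... | no _ | _ = ∑-tailsWithHead F (disjoint ∘ there)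

compositionLYM : ∀ {n} p r (U : Subset n) (F : List (Vec (Subset n) p)) → Unique F →
  (∀ {A} → A ∈ₗ F → DisjointIn U A) → (∀ k → IsChainFree r (PartsAt F k)) →
  ∑[ A ∈ F ] weight U A ≤ r ^ p * ∣ U ∣ !
compositionLYM zero    r U []            _                   _        _  = z≤n
compositionLYM zero    r U ([] ∷ [])     _                   _        _  =
  ≤-reflexive (cong (_+ 0) (*-identityʳ (∣ U ∣ !)))
compositionLYM zero    r U ([] ∷ [] ∷ _) ((≢[] ∷ _) ∷ _)      _        _  = ⊥-elim (≢[] refl)
compositionLYM (suc p) r U F             uniq                disjoint cf = begin
  ∑[ A ∈ F ] weight U A
    ≡⟨ ∑-partition _≟ₛ_ head F D (weight U) (UniqueDec.deduplicate-! _≟ₛ_ (map head F)) head∈D ⟩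
  ∑[ B ∈ D ] ∑[ A ∈ F ] 𝟙 (head A ≟ₛ B) * weight U A
    ≡⟨ ∑-cong D (λ {B} _ → ∑-tailsWithHead B F disjoint) ⟩
  ∑[ B ∈ D ] ∣ B ∣ ! * ∑ (tailsWithHead B F) (weight (U ─ B))
    ≤⟨ ∑-mono-≤ D (λ {B} _ → *-monoʳ-≤ (∣ B ∣ !) (tails-bound B)) ⟩
  ∑[ B ∈ D ] ∣ B ∣ ! * (r ^ p * ∣ U ─ B ∣ !)
    ≡⟨ ∑-cong D (λ {B} B∈D → trans (x∙yz≈y∙xz (∣ B ∣ !) (r ^ p) _)
         (cong (λ k → r ^ p * (∣ B ∣ ! * k !)) (q⊆p⇒∣p─q∣≡∣p∣∸∣q∣ (D⊆U B∈D)))) ⟩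
  ∑[ B ∈ D ] r ^ p * lubellWeight ∣ U ∣ B
    ≡⟨ *-distribˡ-∑ D (r ^ p) (lubellWeight ∣ U ∣) ⟩
  r ^ p * (∑[ B ∈ D ] lubellWeight ∣ U ∣ B)
    ≤⟨ *-monoʳ-≤ (r ^ p) (lym U r D (UniqueDec.deduplicate-! _≟ₛ_ (map head F)) D⊆U
                              (isChainFree-restrict {P = PartsAt F zero} D⇒parts (cf zero))) ⟩
  r ^ p * (r * ∣ U ∣ !)
    ≡⟨ x∙yz≈y∙xz (r ^ p) r (∣ U ∣ !) ⟩
  r * (r ^ p * ∣ U ∣ !)
    ≡⟨ *-assoc r (r ^ p) (∣ U ∣ !) ⟨
  r ^ suc p * ∣ U ∣ ! ∎
  where
  open ≤-Reasoning
  D = deduplicate _≟ₛ_ (map head F)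
  head∈D : ∀ {A} → A ∈ₗ F → head A ∈ₗ D
  head∈D = ∈-deduplicate⁺ _≟ₛ_ ∘ ∈-map⁺ head
  D⇒parts : ∀ {B} → B ∈ₗ D → PartsAt F zero B
  D⇒parts B∈D with ∈-map⁻ head (∈-deduplicate⁻ _≟ₛ_ (map head F) B∈D)
  ... | C ∷ A , A∈F , refl = C ∷ A , A∈F , refl
  D⊆U : ∀ {B} → B ∈ₗ D → B ⊆ U
  D⊆U B∈D with _ ∷ _ , A∈F , refl ← D⇒parts B∈D = disjointIn-head (disjoint A∈F)
  tails-bound : ∀ B → ∑ (tailsWithHead B F) (weight (U ─ B)) ≤ r ^ p * ∣ U ─ B ∣ !
  tails-bound B = compositionLYM p r (U ─ B) (tailsWithHead B F) (tailsWithHead-unique B uniq)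
    (disjointIn-tail ∘ disjoint ∘ ∈-tailsWithHead⁻ B F)
    (λ k → isChainFree-restrict {P = PartsAt F (suc k)} {Q = PartsAt (tailsWithHead B F) k}
      (λ { (A , A∈ , refl) → B ∷ A , ∈-tailsWithHead⁻ B F A∈ , refl }) (cf (suc k)))

-- Tuples and multinomial coefficients

tuples-suc : ∀ n k →
  tuples n (suc k) ≡ concatMap (λ a → map (a ∷_) (tuples (n ∸ a) k)) (upTo (suc n))
tuples-suc zero    k = refl
tuples-suc (suc n) k = refl

sum-∷-split : ∀ {k n a} (v : Vec ℕ k) → Vec.sum (a ∷ v) ≡ n → a ≤ n × Vec.sum v ≡ n ∸ a
sum-∷-split {a = a} v refl = m≤m+n a (Vec.sum v) , sym (m+n∸m≡n a (Vec.sum v))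

∈-tuples⁺ : ∀ n k (v : Vec ℕ k) → Vec.sum v ≡ n → v ∈ₗ tuples n k
∈-tuples⁺ _ zero    []      refl = here refl
∈-tuples⁺ n (suc k) (a ∷ v) ∑≡n with a≤n , ∑v≡n∸a ← sum-∷-split v ∑≡n rewrite tuples-suc n k =
  ∈-concatMap⁺ (λ b → map (b ∷_) (tuples (n ∸ b) k))
    (lose (∈-upTo⁺ (s≤s a≤n)) (∈-map⁺ (a ∷_) (∈-tuples⁺ (n ∸ a) k v ∑v≡n∸a)))

∈-tuples⁻ : ∀ n k (v : Vec ℕ k) → v ∈ₗ tuples n k → Vec.sum v ≡ n
∈-tuples⁻ zero    zero    []      _  = refl
∈-tuples⁻ (suc n) zero    []      ()
∈-tuples⁻ n       (suc k) (a ∷ v) v∈ rewrite tuples-suc n k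
  with b , b∈ , bv∈ ← find (∈-concatMap⁻ (λ b → map (b ∷_) (tuples (n ∸ b) k)) v∈)
  with v′ , v′∈ , refl ← ∈-map⁻ (b ∷_) bv∈ =
  trans (cong (b +_) (∈-tuples⁻ (n ∸ b) k v′ v′∈)) (m+[n∸m]≡n (s≤s⁻¹ (∈-upTo⁻ b∈)))

module _ {k} (T : ℕ → List (Vec ℕ k)) where

  head-∈-concatMap : ∀ xs {v} → v ∈ₗ concatMap (λ a → map (a ∷_) (T a)) xs → Vec.head v ∈ₗ xs
  head-∈-concatMap (x ∷ xs) v∈ with ∈-++⁻ (map (x ∷_) (T x)) v∈
  ... | inj₁ v∈x with _ , _ , refl ← ∈-map⁻ (x ∷_) v∈x = here refl
  ... | inj₂ v∈xs = there (head-∈-concatMap xs v∈xs)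

  concatMap-∷-unique : ∀ {xs} → Unique xs → (∀ a → Unique (T a)) →
    Unique (concatMap (λ a → map (a ∷_) (T a)) xs)
  concatMap-∷-unique {[]}     []                T⁺ = []
  concatMap-∷-unique {x ∷ xs} uniq@(_ ∷ uniq′) T⁺ =
    Unique.++⁺ (Unique.map⁺ ∷-injectiveʳ (T⁺ x)) (concatMap-∷-unique uniq′ T⁺) prefix-disjoint
    where
    prefix-disjoint : Disjoint (map (x ∷_) (T x)) (concatMap (λ a → map (a ∷_) (T a)) xs)
    prefix-disjoint (v∈x , v∈xs) with _ , _ , refl ← ∈-map⁻ (x ∷_) v∈x =
      Unique.Unique[x∷xs]⇒x∉xs uniq (head-∈-concatMap xs v∈xs)

tuples-unique : ∀ n k → Unique (tuples n k)
tuples-unique zero    zero    = [] ∷ []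
tuples-unique (suc n) zero    = []
tuples-unique n       (suc k) rewrite tuples-suc n k =
  concatMap-∷-unique (λ a → tuples (n ∸ a) k) (Unique.upTo⁺ (suc n)) (λ a → tuples-unique (n ∸ a) k)

prodFact∣n! : ∀ {k} n (v : Vec ℕ k) → Vec.sum v ≡ n → prodFact v ∣ n !
prodFact∣n! n []      _   = 1∣ (n !)
prodFact∣n! n (a ∷ v) ∑≡n with a≤n , ∑v≡n∸a ← sum-∷-split v ∑≡n =
  ∣-trans (*-monoʳ-∣ (a !) (prodFact∣n! (n ∸ a) v ∑v≡n∸a)) (k![n∸k]!∣n! a≤n)

multinomial*prodFact≡n! : ∀ {k} n (v : Vec ℕ k) → Vec.sum v ≡ n → multinomial n v * prodFact v ≡ n !
multinomial*prodFact≡n! n v ∑≡n = m/n*n≡m {{prodFact≢0 v}} (prodFact∣n! n v ∑≡n)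

-- Sums of largest entries

AllPairs-reverse : ∀ {a r} {A : Set a} {R : A → A → Set r} {xs} →
  AllPairs R xs → AllPairs (flip R) (reverse xs)
AllPairs-reverse {xs = []}     []                = []
AllPairs-reverse {xs = x ∷ xs} (x∼xs ∷ xs-pairs) rewrite unfold-reverse x xs =
  AllPairs.++⁺ (AllPairs-reverse xs-pairs) ([] ∷ [])
    (All.tabulate λ y∈ → All.lookup x∼xs (Any.reverse⁻ y∈) ∷ [])

all≤sum : ∀ xs → All (_≤ sum xs) xs
all≤sum []       = []
all≤sum (x ∷ xs) = m≤m+n x (sum xs) ∷ All.map (λ y≤ → ≤-trans y≤ (m≤n+m (sum xs) x)) (all≤sum xs)

-- The threshold t is the R-th largest entry (u if R = 0, and 0 if there are fewer than R entries).
descending-threshold : ∀ R ds {u} → AllPairs _≥_ ds → All (_≤ u) ds →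
  ∃ λ t → t ≤ u × R * t + (∑[ d ∈ ds ] (d ∸ t)) ≤ sum (take R ds)
descending-threshold zero    ds       {u} _ ds≤u =
  u , ≤-refl , ≤-reflexive (trans (∑-cong ds (m≤n⇒m∸n≡0 ∘ All.lookup ds≤u)) (∑-zero ds))
descending-threshold (suc R) []       _ _ =
  0 , z≤n , ≤-reflexive (trans (+-identityʳ (suc R * 0)) (*-zeroʳ (suc R)))
descending-threshold (suc R) (d ∷ ds) (d≥ds ∷ descending) (d≤u ∷ _)
  with t , t≤d , bound ← descending-threshold R ds descending d≥ds = t , ≤-trans t≤d d≤u , (begin
    suc R * t + ((d ∸ t) + S)   ≡⟨ rearrange R t (d ∸ t) S ⟩
    (t + (d ∸ t)) + (R * t + S) ≡⟨ cong (_+ (R * t + S)) (m+[n∸m]≡n t≤d) ⟩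
    d + (R * t + S)             ≤⟨ +-monoʳ-≤ d bound ⟩
    d + sum (take R ds)         ∎)
  where
  open ≤-Reasoning
  open +-*-Solver
  S = ∑[ d′ ∈ ds ] (d′ ∸ t)
  rearrange : ∀ R t e S → suc R * t + (e + S) ≡ (t + e) + (R * t + S)
  rearrange = solve 4 (λ R t e S → (con 1 :+ R) :* t :+ (e :+ S) := (t :+ e) :+ (R :* t :+ S)) refl

sumLargest-threshold : ∀ R xs → ∃ λ t → R * t + (∑[ x ∈ xs ] (x ∸ t)) ≤ sumLargest R xs
sumLargest-threshold R xs
  with t , _ , bound ← descending-threshold R (reverse (sort xs))
                         (AllPairs-reverse (Linked⇒AllPairs ≤-trans (sort-↗ xs))) (all≤sum _) =
  t , subst (λ s → R * t + s ≤ sumLargest R xs) (sum-↭ (Perm.map⁺ (_∸ t) reverse-sort↭xs)) bound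
  where
  reverse-sort↭xs : reverse (sort xs) ↭ xs
  reverse-sort↭xs = ↭-trans (Perm.↭-reverse (sort xs)) (sort-↭ xs)

-- x ≤ (c ∸ t) + t x / c, with the denominator c cleared by multiplying through by c P.
threshold-split : ∀ {x c} t P → x ≤ c → x * (c * P) ≤ (c ∸ t) * (c * P) + t * (x * P)
threshold-split {x} {c} t P x≤c = begin
  x * (c * P)                     ≡⟨ *-assoc x c P ⟨
  x * c * P                       ≤⟨ *-monoˡ-≤ P (split (≤-total t c)) ⟩
  ((c ∸ t) * c + t * x) * P       ≡⟨ *-distribʳ-+ P ((c ∸ t) * c) (t * x) ⟩
  (c ∸ t) * c * P + t * x * P     ≡⟨ cong₂ _+_ (*-assoc (c ∸ t) c P) (*-assoc t x P) ⟩
  (c ∸ t) * (c * P) + t * (x * P) ∎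
  where
  open ≤-Reasoning
  split : t ≤ c ⊎ c ≤ t → x * c ≤ (c ∸ t) * c + t * x
  split (inj₁ t≤c) = begin
    x * c               ≡⟨ cong (x *_) (m∸n+n≡m t≤c) ⟨
    x * ((c ∸ t) + t)   ≡⟨ *-distribˡ-+ x (c ∸ t) t ⟩
    x * (c ∸ t) + x * t ≤⟨ +-monoˡ-≤ (x * t) (*-monoˡ-≤ (c ∸ t) x≤c) ⟩
    c * (c ∸ t) + x * t ≡⟨ cong₂ _+_ (*-comm c (c ∸ t)) (*-comm x t) ⟩
    (c ∸ t) * c + t * x ∎
  split (inj₂ c≤t) = begin
    x * c               ≤⟨ *-monoʳ-≤ x c≤t ⟩
    x * t               ≡⟨ *-comm x t ⟩
    t * x               ≤⟨ m≤n+m (t * x) ((c ∸ t) * c) ⟩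
    (c ∸ t) * c + t * x ∎

∑≤sumLargest : ∀ {a} {V : Set a} (T : List V) (x c P : V → ℕ) R N .{{_ : NonZero N}} →
  (∀ {v} → v ∈ₗ T → c v * P v ≡ N) → (∀ {v} → v ∈ₗ T → x v ≤ c v) →
  ∑[ v ∈ T ] x v * P v ≤ R * N → ∑ T x ≤ sumLargest R (map c T)
∑≤sumLargest T x c P R N cP≡N x≤c ∑xP≤RN
  with t , threshold ← sumLargest-threshold R (map c T) = begin
  ∑ T x                              ≤⟨ *-cancelʳ-≤ (∑ T x) (excess + R * t) N scaled ⟩
  excess + R * t                     ≡⟨ +-comm excess (R * t) ⟩
  R * t + excess                     ≡⟨ cong (R * t +_) (∑-map T c (_∸ t)) ⟨
  R * t + (∑[ y ∈ map c T ] (y ∸ t)) ≤⟨ threshold ⟩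
  sumLargest R (map c T)             ∎
  where
  open ≤-Reasoning
  excess = ∑[ v ∈ T ] (c v ∸ t)
  split : ∀ {v} → v ∈ₗ T → x v * N ≤ (c v ∸ t) * N + t * (x v * P v)
  split {v} v∈T = subst (λ N → x v * N ≤ (c v ∸ t) * N + t * (x v * P v)) (cP≡N v∈T)
                        (threshold-split t (P v) (x≤c v∈T))
  scaled : ∑ T x * N ≤ (excess + R * t) * N
  scaled = begin
    ∑ T x * N                                         ≡⟨ *-distribʳ-∑ T N x ⟨
    ∑[ v ∈ T ] x v * N                                ≤⟨ ∑-mono-≤ T split ⟩
    ∑[ v ∈ T ] (c v ∸ t) * N + t * (x v * P v)        ≡⟨ ∑-distrib-+ T (λ v → (c v ∸ t) * N) _ ⟩
    (∑[ v ∈ T ] (c v ∸ t) * N) + (∑[ v ∈ T ] t * (x v * P v))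
      ≡⟨ cong₂ _+_ (*-distribʳ-∑ T N (λ v → c v ∸ t)) (*-distribˡ-∑ T t (λ v → x v * P v)) ⟩
    excess * N + t * (∑[ v ∈ T ] x v * P v)           ≤⟨ +-monoʳ-≤ (excess * N) (*-monoʳ-≤ t ∑xP≤RN) ⟩
    excess * N + t * (R * N)                          ≡⟨ cong (excess * N +_) (x∙yz≈y∙xz t R N) ⟩
    excess * N + R * (t * N)                          ≡⟨ cong (excess * N +_) (*-assoc R t N) ⟨
    excess * N + R * t * N                            ≡⟨ *-distribʳ-+ N excess (R * t) ⟨
    (excess + R * t) * N                              ∎

-- Counting compositions by profile

_≟ᵥ_ : ∀ {k} → DecidableEquality (Vec ℕ k)
_≟ᵥ_ = ≡-dec _≟_

module _ {n p} (r : ℕ) (F : List (WeakPartialComposition n p)) (F-unique : Unique F)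
         (F-disjoint : ∀ {A} → A ∈ₗ F → DisjointIn ⊤ A)
         (F-chainFree : ∀ k → IsChainFree r (PartsAt F k)) where

  private
    T = tuples n (suc p)

  multiplicity : Vec ℕ (suc p) → ℕ
  multiplicity v = ∑[ A ∈ F ] 𝟙 (profile ⊤ A ≟ᵥ v)

  profile∈tuples : ∀ {A} → A ∈ₗ F → profile ⊤ A ∈ₗ T
  profile∈tuples A∈F = ∈-tuples⁺ n (suc p) _ (trans (sum-profile (F-disjoint A∈F)) (∣⊤∣≡n n))

  ∑-by-profile : ∀ (f : Vec ℕ (suc p) → ℕ) →
    ∑[ A ∈ F ] f (profile ⊤ A) ≡ ∑[ v ∈ T ] multiplicity v * f v
  ∑-by-profile f = begin
    ∑[ A ∈ F ] f (profile ⊤ A)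
      ≡⟨ ∑-partition _≟ᵥ_ (profile ⊤) F T (f ∘ profile ⊤) (tuples-unique n (suc p)) profile∈tuples ⟩
    ∑[ v ∈ T ] ∑[ A ∈ F ] 𝟙 (profile ⊤ A ≟ᵥ v) * f (profile ⊤ A)
      ≡⟨ ∑-cong T (λ {v} _ → ∑-cong F (λ {A} _ → 𝟙≡-*-cong (profile ⊤ A ≟ᵥ v) f)) ⟨
    ∑[ v ∈ T ] ∑[ A ∈ F ] 𝟙 (profile ⊤ A ≟ᵥ v) * f v
      ≡⟨ ∑-cong T (λ {v} _ → *-distribʳ-∑ F (f v) _) ⟩
    ∑[ v ∈ T ] multiplicity v * f v ∎
    where open ≡-Reasoning

  length≡∑multiplicity : length F ≡ ∑ T multiplicity
  length≡∑multiplicity = begin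
    length F                       ≡⟨ ∑-one F ⟨
    ∑[ A ∈ F ] 1                   ≡⟨ ∑-by-profile (λ _ → 1) ⟩
    ∑[ v ∈ T ] multiplicity v * 1  ≡⟨ ∑-cong T (λ {v} _ → *-identityʳ (multiplicity v)) ⟩
    ∑ T multiplicity               ∎
    where open ≡-Reasoning

  ∑multiplicity*prodFact≤ : ∑[ v ∈ T ] multiplicity v * prodFact v ≤ r ^ p * n !
  ∑multiplicity*prodFact≤ = begin
    ∑[ v ∈ T ] multiplicity v * prodFact v ≡⟨ ∑-by-profile prodFact ⟨
    ∑[ A ∈ F ] weight ⊤ A                  ≤⟨ compositionLYM p r ⊤ F F-unique F-disjoint F-chainFree ⟩
    r ^ p * ∣ ⊤ {n} ∣ !                     ≡⟨ cong (λ k → r ^ p * k !) (∣⊤∣≡n n) ⟩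
    r ^ p * n !                            ∎
    where open ≤-Reasoning

  multiplicity*prodFact≤ : ∀ v → multiplicity v * prodFact v ≤ n !
  multiplicity*prodFact≤ v = begin
    multiplicity v * prodFact v
      ≡⟨ *-distribʳ-∑ F (prodFact v) _ ⟨
    ∑[ A ∈ F ] 𝟙 (profile ⊤ A ≟ᵥ v) * prodFact v
      ≡⟨ ∑-cong F (λ {A} _ → 𝟙≡-*-cong (profile ⊤ A ≟ᵥ v) prodFact) ⟩
    ∑[ A ∈ F ] 𝟙 (profile ⊤ A ≟ᵥ v) * weight ⊤ A
      ≡⟨ ∑-filter (λ A → profile ⊤ A ≟ᵥ v) F (weight ⊤) ⟨
    ∑ Fᵥ (weight ⊤)
      ≤⟨ compositionLYM p 1 ⊤ Fᵥ (Unique.filter⁺ _ F-unique) (F-disjoint ∘ proj₁ ∘ ∈-Fᵥ⁻)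
           (λ k → equalSize⇒isChainFree1 {P = PartsAt Fᵥ k} (size k)) ⟩
    1 ^ p * ∣ ⊤ {n} ∣ !
      ≡⟨ cong₂ (λ a k → a * k !) (^-zeroˡ p) (∣⊤∣≡n n) ⟩
    1 * n !
      ≡⟨ *-identityˡ (n !) ⟩
    n ! ∎
    where
    open ≤-Reasoning
    Fᵥ = filter (λ A → profile ⊤ A ≟ᵥ v) F
    ∈-Fᵥ⁻ : ∀ {A} → A ∈ₗ Fᵥ → A ∈ₗ F × profile ⊤ A ≡ v
    ∈-Fᵥ⁻ = ∈-filter⁻ (λ A → profile ⊤ A ≟ᵥ v)
    size : ∀ k {S} → PartsAt Fᵥ k S → ∣ S ∣ ≡ lookup v (suc k)
    size k (A , A∈Fᵥ , refl) =
      trans (sym (lookup-map k ∣_∣ A)) (cong (λ w → lookup w (suc k)) (proj₂ (∈-Fᵥ⁻ A∈Fᵥ)))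

  multiplicity≤multinomial : ∀ {v} → v ∈ₗ T → multiplicity v ≤ multinomial n v
  multiplicity≤multinomial {v} v∈T =
    *-cancelʳ-≤ (multiplicity v) (multinomial n v) (prodFact v) {{prodFact≢0 v}}
      (≤-trans (multiplicity*prodFact≤ v)
               (≤-reflexive (sym (multinomial*prodFact≡n! n v (∈-tuples⁻ n (suc p) v v∈T)))))

  length≤sumLargest : length F ≤ sumLargest (r ^ p) (multinomials n (suc p))
  length≤sumLargest = begin
    length F         ≡⟨ length≡∑multiplicity ⟩
    ∑ T multiplicity ≤⟨ ∑≤sumLargest T multiplicity (multinomial n) prodFact (r ^ p) (n !) {{n !≢0}}
                          (λ {v} v∈T → multinomial*prodFact≡n! n v (∈-tuples⁻ n (suc p) v v∈T))
                          multiplicity≤multinomial ∑multiplicity*prodFact≤ ⟩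
    sumLargest (r ^ p) (multinomials n (suc p)) ∎
    where open ≤-Reasoning

corollary4p2 : (p r n m : ℕ) → 2 ≤ p → 1 ≤ r →
    (A : Fin m → WeakPartialComposition n p) →
    (∀ j → PairwiseDisjoint (A j)) →
    Injective _≡_ _≡_ A →
    (∀ (k : Fin p) → ChainFree r (λ j → lookup (A j) k)) →
    m ≤ sumLargest (r ^ p) (multinomials n (suc p))
corollary4p2 p r n m _ _ A disjoint injective chainFree = begin
  m                   ≡⟨ length-tabulate A ⟨
  length (tabulate A) ≤⟨ length≤sumLargest r (tabulate A) (Unique.tabulate⁺ injective)
                           members-disjoint parts-chainFree ⟩
  sumLargest (r ^ p) (multinomials n (suc p)) ∎
  where
  open ≤-Reasoning
  members-disjoint : ∀ {A′} → A′ ∈ₗ tabulate A → DisjointIn ⊤ A′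
  members-disjoint A′∈ with j , refl ← ∈-tabulate⁻ A′∈ =
    pairwiseDisjoint⇒disjointIn (A j) (disjoint j) (λ _ _ → ∈⊤)
  parts-chainFree : ∀ k → IsChainFree r (PartsAt (tabulate A) k)
  parts-chainFree k = isChainFree-restrict {Q = PartsAt (tabulate A) k} part⇒column (chainFree k)
    where
    part⇒column : ∀ {S} → PartsAt (tabulate A) k S → ∃ λ j → lookup (A j) k ≡ S
    part⇒column (A′ , A′∈ , refl) with j , refl ← ∈-tabulate⁻ A′∈ = j , refl
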